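{- For every cograph $G$, $\chi_a(G)=\mathrm{tw}(G)+1$.
   Context: Cographs: a single vertex is a cograph; disjoint unions and joins (disjoint union plus all edges between distinct parts) of cographs are cographs. $\chi_a(G)$ is the minimum number of colors in an acyclic coloring, i.e. a proper vertex coloring in which the union of any two color classes induces a forest. A triangulation of $G=(V,E)$ is a chordal graph $(V,E^+)$ with $E\subseteq E^+$; the treewidth $\mathrm{tw}(G)$ is the minimum of $\omega(G^+)-1$ over all triangulations $G^+$ of $G$, where $\omega$ denotes the clique number. -}

module Defs where

open import Data.Nat using (ℕ; zero; suc; _+_; _≤_; _<?_)
open import Data.Fin using (Fin; zero; suc; toℕ; fromℕ<; splitAt; _↑ˡ_; _↑ʳ_)
open import Data.Bool using (Bool; true; false)
open import Data.Sum using (_⊎_; inj₁; inj₂)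
open import Data.Product using (Σ; _×_; _,_; ∃)
open import Data.Empty using (⊥)
open import Relation.Nullary using (¬_; yes; no)
open import Relation.Binary.PropositionalEquality using (_≡_; _≢_)
open import Function.Definitions using (Injective)

record Graph : Set where
  field
    n      : ℕ
    adj    : Fin n → Fin n → Bool
    sym    : ∀ u v → adj u v ≡ adj v u
    irrefl : ∀ v → adj v v ≡ false
open Graph public

Adj : (G : Graph) → Fin (n G) → Fin (n G) → Set
Adj G u v = adj G u v ≡ true

record _≅_ (G H : Graph) : Set where
  field
    to      : Fin (n G) → Fin (n H)
    from    : Fin (n H) → Fin (n G)
    from∘to : ∀ v → from (to v) ≡ v
    to∘from : ∀ v → to (from v) ≡ v
    pres    : ∀ u v → adj H (to u) (to v) ≡ adj G u v

-- adjacency of the disjoint union (b = false) or join (b = true)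
-- of G and H, on vertex set Fin (n G + n H)
combAdj : (b : Bool) (G H : Graph) → Fin (n G + n H) → Fin (n G + n H) → Bool
combAdj b G H u v with splitAt (n G) u | splitAt (n G) v
... | inj₁ x | inj₁ y = adj G x y
... | inj₂ x | inj₂ y = adj H x y
... | inj₁ _ | inj₂ _ = b
... | inj₂ _ | inj₁ _ = b

combSym : ∀ b G H u v → combAdj b G H u v ≡ combAdj b G H v u
combSym b G H u v with splitAt (n G) u | splitAt (n G) v
... | inj₁ x | inj₁ y = sym G x y
... | inj₂ x | inj₂ y = sym H x y
... | inj₁ _ | inj₂ _ = Relation.Binary.PropositionalEquality.refl
... | inj₂ _ | inj₁ _ = Relation.Binary.PropositionalEquality.refl

combIrr : ∀ b G H v → combAdj b G H v v ≡ false
combIrr b G H v with splitAt (n G) v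
... | inj₁ x = irrefl G x
... | inj₂ x = irrefl H x

combine : Bool → Graph → Graph → Graph
combine b G H = record
  { n = n G + n H ; adj = combAdj b G H ; sym = combSym b G H ; irrefl = combIrr b G H }

K₁ : Graph
K₁ = record { n = 1 ; adj = λ _ _ → false
            ; sym = λ _ _ → Relation.Binary.PropositionalEquality.refl
            ; irrefl = λ _ → Relation.Binary.PropositionalEquality.refl }

data IsCograph : Graph → Set where
  single : IsCograph K₁
  union  : ∀ {G H} → IsCograph G → IsCograph H → IsCograph (combine false G H)
  join   : ∀ {G H} → IsCograph G → IsCograph H → IsCograph (combine true G H)
  iso    : ∀ {G H} → G ≅ H → IsCograph G → IsCograph H

cycSuc : ∀ {m} → Fin (suc m) → Fin (suc m)
cycSuc {m} i with suc (toℕ i) <? suc m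
... | yes p = fromℕ< p
... | no _  = zero

record CycleIn (G : Graph) (P : Fin (n G) → Set) (l : ℕ) : Set where
  field
    vtx    : Fin (3 + l) → Fin (n G)
    inj    : Injective _≡_ _≡_ vtx
    inP    : ∀ i → P (vtx i)
    edges  : ∀ i → Adj G (vtx i) (vtx (cycSuc i))
open CycleIn public

InducesForest : (G : Graph) → (Fin (n G) → Set) → Set
InducesForest G P = ∀ l → ¬ CycleIn G P l

record AcyclicColoring (G : Graph) (k : ℕ) : Set where
  field
    col     : Fin (n G) → Fin k
    proper  : ∀ u v → Adj G u v → col u ≢ col v
    acyclic : ∀ (a b : Fin k) → InducesForest G (λ v → (col v ≡ a) ⊎ (col v ≡ b))

IsAcyclicChromaticNumber : Graph → ℕ → Set
IsAcyclicChromaticNumber G k =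
  AcyclicColoring G k × (∀ j → AcyclicColoring G j → k ≤ j)

Chordal : Graph → Set
Chordal G = ∀ l (C : CycleIn G (λ _ → Data.Unit.⊤) (suc l)) →
  Σ (Fin (4 + l)) λ i → Σ (Fin (4 + l)) λ j →
    Adj G (vtx C i) (vtx C j) × i ≢ j × j ≢ cycSuc i × i ≢ cycSuc j
  where import Data.Unit

record Clique (G : Graph) (w : ℕ) : Set where
  field
    cv    : Fin w → Fin (n G)
    cinj  : Injective _≡_ _≡_ cv
    cadj  : ∀ i j → i ≢ j → Adj G (cv i) (cv j)

IsCliqueNumber : Graph → ℕ → Set
IsCliqueNumber G w = Clique G w × (∀ j → Clique G j → j ≤ w)

record Triangulation (G : Graph) : Set where
  field
    tadj    : Fin (n G) → Fin (n G) → Bool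
    tsym    : ∀ u v → tadj u v ≡ tadj v u
    tirr    : ∀ v → tadj v v ≡ false
    super   : ∀ u v → Adj G u v → tadj u v ≡ true

  tri : Graph
  tri = record { n = n G ; adj = tadj ; sym = tsym ; irrefl = tirr }

  field
    chordal : Chordal tri
open Triangulation public

-- tw(G) = t : t + 1 is the minimum clique number over triangulations
IsTreewidth : Graph → ℕ → Set
IsTreewidth G t =
  (Σ (Triangulation G) λ T → IsCliqueNumber (tri T) (suc t)) ×
  (∀ (T : Triangulation G) w → IsCliqueNumber (tri T) w → suc t ≤ w)

-- χₐ and tw + 1 obey the same recursion along a cotree: both are 1 on a vertex, the larger of the
-- two values on a disjoint union, and min (k_G + |H|) (k_H + |G|) on a join of G and H.
-- In a join, two monochromatic pairs, one on each side, would span a two-colored 4-cycle, so some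
-- side, say H, is colored injectively and its |H| colors are lost to G; dually, two non-edges of a
-- triangulation, one on each side, would span a chordless 4-cycle, so some side becomes a clique.
-- Optimal solutions for G together with an injective coloring, resp. a clique, on H attain these
-- bounds. The induction therefore carries, for every cograph, matching upper and lower bounds for
-- both parameters at the same value.

module Submission where

open import Defs
open import Data.Nat using (ℕ; suc)
open import Data.Product using (Σ; _×_)

open import Data.Bool using (Bool; true; false)
import Data.Bool as Bool
open import Data.Empty using (⊥; ⊥-elim)
open import Data.Fin using (Fin; zero; suc; toℕ; fromℕ<; splitAt; _↑ˡ_; _↑ʳ_; inject≤)
import Data.Fin as Fin
open import Data.Fin.Patterns using (0F; 1F; 2F; 3F)
import Data.Fin.Properties as FinP
open import Data.Nat using (zero; _+_; _≤_; _<_; _<?_; z≤n; s≤s)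
import Data.Nat.Properties as ℕP
open import Data.Product using (_,_; ∃; ∃₂; proj₁; proj₂; map₂)
open import Data.Sum using (_⊎_; inj₁; inj₂)
import Data.Sum as Sum
import Data.Sum.Properties as SumP
open import Data.Unit using (⊤; tt)
open import Data.Vec.Functional using (_++_; _∷_)
open import Data.Vec.Functional.Properties using (lookup-++ˡ; lookup-++ʳ)
open import Function using (_∘_; id)
open import Function.Definitions using (Injective)
open import Relation.Nullary using (¬_; yes; no; Dec)
open import Relation.Nullary.Decidable using (⌊_⌋; ¬?; _×-dec_; decidable-stable)
import Relation.Binary.PropositionalEquality as ≡
open ≡ using (_≡_; _≢_; refl; trans; cong; subst; subst₂)

open AcyclicColoring
open Clique

↑ˡ≢↑ʳ : ∀ {m k} (x : Fin m) (y : Fin k) → x ↑ˡ k ≢ m ↑ʳ y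
↑ˡ≢↑ʳ {m} {k} x y e
  with trans (≡.sym (FinP.splitAt-↑ˡ m x k)) (trans (cong (splitAt m) e) (FinP.splitAt-↑ʳ m k y))
... | ()

data Side (m k : ℕ) : Fin (m + k) → Set where
  left  : (x : Fin m) → Side m k (x ↑ˡ k)
  right : (y : Fin k) → Side m k (m ↑ʳ y)

side : ∀ m k (u : Fin (m + k)) → Side m k u
side m k u with splitAt m u in eq
... | inj₁ x = subst (Side m k) (FinP.splitAt⁻¹-↑ˡ eq) (left x)
... | inj₂ y = subst (Side m k) (FinP.splitAt⁻¹-↑ʳ eq) (right y)

++-injective : ∀ {m k j} {xs : Fin m → Fin j} {ys : Fin k → Fin j} →
  Injective _≡_ _≡_ xs → Injective _≡_ _≡_ ys → (∀ x y → xs x ≢ ys y) →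
  Injective _≡_ _≡_ (xs ++ ys)
++-injective {m} {k} {xs = xs} {ys} xs-inj ys-inj disjoint {u} {v} e
  with side m k u | side m k v
... | left x  | left x'  = cong (_↑ˡ k) (xs-inj (subst₂ _≡_ (lookup-++ˡ xs ys x) (lookup-++ˡ xs ys x') e))
... | right y | right y' = cong (m ↑ʳ_) (ys-inj (subst₂ _≡_ (lookup-++ʳ xs ys y) (lookup-++ʳ xs ys y') e))
... | left x  | right y  = ⊥-elim (disjoint x y (subst₂ _≡_ (lookup-++ˡ xs ys x) (lookup-++ʳ xs ys y) e))
... | right y | left x   =
  ⊥-elim (disjoint x y (subst₂ _≡_ (lookup-++ˡ xs ys x) (lookup-++ʳ xs ys y) (≡.sym e)))

∷-injective : ∀ {m j} {a : Fin j} {s : Fin m → Fin j} →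
  (∀ i → a ≢ s i) → Injective _≡_ _≡_ s → Injective _≡_ _≡_ (a ∷ s)
∷-injective a∉s s-inj {zero}  {zero}  e = refl
∷-injective a∉s s-inj {zero}  {suc j} e = ⊥-elim (a∉s j e)
∷-injective a∉s s-inj {suc i} {zero}  e = ⊥-elim (a∉s i (≡.sym e))
∷-injective a∉s s-inj {suc i} {suc j} e = cong suc (s-inj e)

pairwise-or-counterexample : ∀ {a} {R : Fin a → Fin a → Set} → (∀ x y → Dec (R x y)) →
  (∀ x y → x ≢ y → R x y) ⊎ ∃₂ λ x y → x ≢ y × ¬ R x y
pairwise-or-counterexample R?
  with FinP.any? (λ x → FinP.any? (λ y → ¬? (x FinP.≟ y) ×-dec ¬? (R? x y)))
... | yes (x , y , x≢y , ¬Rxy) = inj₂ (x , y , x≢y , ¬Rxy)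
... | no ¬∃ = inj₁ λ x y x≢y → decidable-stable (R? x y) (λ ¬Rxy → ¬∃ (x , y , x≢y , ¬Rxy))

injective-or-collision : ∀ {a j} (f : Fin a → Fin j) →
  Injective _≡_ _≡_ f ⊎ ∃₂ λ x y → x ≢ y × f x ≡ f y
injective-or-collision f with pairwise-or-counterexample (λ x y → ¬? (f x FinP.≟ f y))
... | inj₁ distinct = inj₁ λ {x} {y} e → decidable-stable (x FinP.≟ y) (λ x≢y → distinct x y x≢y e)
... | inj₂ (x , y , x≢y , ¬≢) = inj₂ (x , y , x≢y , decidable-stable (f x FinP.≟ f y) ¬≢)

record Partition (w : ℕ) (P : Fin w → Set) : Set where
  field
    size₁ size₂ : ℕ
    sizes : size₁ + size₂ ≡ w
    part₁ : Fin size₁ → Fin w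
    part₁-injective : Injective _≡_ _≡_ part₁
    part₁-P : ∀ i → P (part₁ i)
    part₂ : Fin size₂ → Fin w
    part₂-injective : Injective _≡_ _≡_ part₂
    part₂-¬P : ∀ i → ¬ P (part₂ i)

partition : ∀ w {P : Fin w → Set} → (∀ i → Dec (P i)) → Partition w P
partition zero P? = record
  { size₁ = 0 ; size₂ = 0 ; sizes = refl
  ; part₁ = λ () ; part₁-injective = λ { {()} } ; part₁-P = λ ()
  ; part₂ = λ () ; part₂-injective = λ { {()} } ; part₂-¬P = λ () }
partition (suc w) P? with partition w (P? ∘ suc) | P? zero
... | S | yes P0 = record
  { size₁ = suc size₁ ; size₂ = size₂ ; sizes = cong suc sizes
  ; part₁ = zero ∷ suc ∘ part₁
  ; part₁-injective = ∷-injective (λ _ ()) (part₁-injective ∘ FinP.suc-injective)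
  ; part₁-P = λ { zero → P0 ; (suc i) → part₁-P i }
  ; part₂ = suc ∘ part₂ ; part₂-injective = part₂-injective ∘ FinP.suc-injective
  ; part₂-¬P = part₂-¬P }
  where open Partition S
... | S | no ¬P0 = record
  { size₁ = size₁ ; size₂ = suc size₂ ; sizes = trans (ℕP.+-suc size₁ size₂) (cong suc sizes)
  ; part₁ = suc ∘ part₁ ; part₁-injective = part₁-injective ∘ FinP.suc-injective ; part₁-P = part₁-P
  ; part₂ = zero ∷ suc ∘ part₂
  ; part₂-injective = ∷-injective (λ _ ()) (part₂-injective ∘ FinP.suc-injective)
  ; part₂-¬P = λ { zero → ¬P0 ; (suc i) → part₂-¬P i } }
  where open Partition S

CycStep : ℕ → ℕ → ℕ → Set
CycStep N a b = b ≡ suc a ⊎ (b ≡ 0 × suc a ≡ N)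

cycSuc-step : ∀ {m} (i : Fin (suc m)) → CycStep (suc m) (toℕ i) (toℕ (cycSuc i))
cycSuc-step {m} i with suc (toℕ i) <? suc m
... | yes i+1<N = inj₁ (FinP.toℕ-fromℕ< i+1<N)
... | no  i+1≮N = inj₂ (refl , ℕP.≤-antisym (FinP.toℕ<n i) (ℕP.≮⇒≥ i+1≮N))

cycStep-≢ : ∀ {N a b} → 2 ≤ N → CycStep N a b → b ≢ a
cycStep-≢ _ (inj₁ refl) = ℕP.1+n≢n
cycStep-≢ (s≤s ()) (inj₂ (refl , refl)) refl

cycStep²-≢ : ∀ {N a b c} → 3 ≤ N → CycStep N a b → CycStep N b c → c ≢ a
cycStep²-≢ _ (inj₁ refl) (inj₁ refl) e = ℕP.<-irrefl (≡.sym e) (ℕP.m<n+m _ (s≤s z≤n))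
cycStep²-≢ (s≤s (s≤s ())) (inj₁ refl) (inj₂ (refl , refl)) refl
cycStep²-≢ (s≤s (s≤s ())) (inj₂ (refl , refl)) (inj₁ refl) refl

cycStep³-≢ : ∀ {N a b c d} → 4 ≤ N → CycStep N a b → CycStep N b c → CycStep N c d → d ≢ a
cycStep³-≢ _ (inj₁ refl) (inj₁ refl) (inj₁ refl) e = ℕP.<-irrefl (≡.sym e) (ℕP.m<n+m _ (s≤s z≤n))
cycStep³-≢ (s≤s (s≤s (s≤s ()))) (inj₁ refl) (inj₁ refl) (inj₂ (refl , refl)) refl
cycStep³-≢ (s≤s (s≤s (s≤s ()))) (inj₁ refl) (inj₂ (refl , refl)) (inj₁ refl) refl
cycStep³-≢ _ (inj₁ refl) (inj₂ (refl , refl)) (inj₂ (refl , ()))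
cycStep³-≢ (s≤s (s≤s (s≤s ()))) (inj₂ (refl , refl)) (inj₁ refl) (inj₁ refl) refl

cycSuc-≢ : ∀ {m} (i : Fin (2 + m)) → cycSuc i ≢ i
cycSuc-≢ i = cycStep-≢ (s≤s (s≤s z≤n)) (cycSuc-step i) ∘ cong toℕ

cycSuc²-≢ : ∀ {m} (i : Fin (3 + m)) → cycSuc (cycSuc i) ≢ i
cycSuc²-≢ i = cycStep²-≢ (s≤s (s≤s (s≤s z≤n))) (cycSuc-step i) (cycSuc-step (cycSuc i)) ∘ cong toℕ

cycSuc³-≢ : ∀ {m} (i : Fin (4 + m)) → cycSuc (cycSuc (cycSuc i)) ≢ i
cycSuc³-≢ i = cycStep³-≢ (s≤s (s≤s (s≤s (s≤s z≤n))))
  (cycSuc-step i) (cycSuc-step (cycSuc i)) (cycSuc-step (cycSuc (cycSuc i))) ∘ cong toℕ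

cycSuc-induction : ∀ {m} (Q : Fin (suc m) → Set) → Q 0F → (∀ i → Q i → Q (cycSuc i)) → ∀ i → Q i
cycSuc-induction {m} Q q₀ qₛ i = subst Q (FinP.fromℕ<-toℕ i (FinP.toℕ<n i)) (go (toℕ i) (FinP.toℕ<n i))
  where
  go : ∀ r (r<N : r < suc m) → Q (fromℕ< r<N)
  go zero    _       = q₀
  go (suc r) r+1<N   = subst Q (FinP.toℕ-injective next) (qₛ _ (go r r<N))
    where
    r<N = ℕP.<-trans (ℕP.n<1+n r) r+1<N
    next : toℕ (cycSuc (fromℕ< r<N)) ≡ toℕ (fromℕ< r+1<N)
    next with cycSuc-step (fromℕ< r<N)
    ... | inj₁ e = trans e (trans (cong suc (FinP.toℕ-fromℕ< r<N)) (≡.sym (FinP.toℕ-fromℕ< r+1<N)))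
    ... | inj₂ (_ , e) = ⊥-elim (ℕP.<-irrefl (trans (cong suc (≡.sym (FinP.toℕ-fromℕ< r<N))) e) r+1<N)

no-edge : ∀ {X u v} → adj X u v ≡ false → ¬ Adj X u v
no-edge u≁v u~v with trans (≡.sym u≁v) u~v
... | ()

adj-≢ : ∀ {X u v} → Adj X u v → u ≢ v
adj-≢ {X} {u} u~v refl = no-edge {X} (irrefl X u) u~v

Adj-sym : ∀ {X u v} → Adj X u v → Adj X v u
Adj-sym {X} {u} {v} u~v = trans (sym X v u) u~v

mapCycle : ∀ {X Y : Graph} {P Q l} (f : Fin (n X) → Fin (n Y)) → Injective _≡_ _≡_ f →
  (∀ {u v} → Adj X u v → Adj Y (f u) (f v)) → (∀ {v} → P v → Q (f v)) →
  CycleIn X P l → CycleIn Y Q l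
mapCycle f f-inj f-adj f-P C = record
  { vtx = f ∘ vtx C ; inj = inj C ∘ f-inj ; inP = f-P ∘ inP C ; edges = f-adj ∘ edges C }

weakenCycle : ∀ {X P Q l} → (∀ {v} → P v → Q v) → CycleIn X P l → CycleIn X Q l
weakenCycle = mapCycle id id id

module _ {X : Graph} {P : Fin (n X) → Set} {l : ℕ} (C : CycleIn X P l) where

  cycle-revisits : ∀ {i j w} → i ≢ j → vtx C i ≡ w → vtx C j ≡ w → ⊥
  cycle-revisits i≢j i↦w j↦w = i≢j (inj C (trans i↦w (≡.sym j↦w)))

  cycle-not-within-pair : ∀ {u w} → ¬ (∀ i → vtx C i ≡ u ⊎ vtx C i ≡ w)
  cycle-not-within-pair within with within 0F | within 1F | within 2F
  ... | inj₁ p | inj₁ q | _      = cycle-revisits (λ ()) p q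
  ... | inj₂ p | inj₂ q | _      = cycle-revisits (λ ()) p q
  ... | inj₁ p | inj₂ q | inj₁ r = cycle-revisits (λ ()) p r
  ... | inj₁ p | inj₂ q | inj₂ r = cycle-revisits (λ ()) q r
  ... | inj₂ p | inj₁ q | inj₁ r = cycle-revisits (λ ()) q r
  ... | inj₂ p | inj₁ q | inj₂ r = cycle-revisits (λ ()) p r

  cycle-not-star : ∀ h → ¬ (∀ i → vtx C i ≡ h ⊎ vtx C (cycSuc i) ≡ h)
  cycle-not-star h through with through 0F | through 1F | through 2F
  ... | inj₁ p | inj₁ q | _      = cycle-revisits (λ ()) p q
  ... | inj₁ p | inj₂ q | _      = cycle-revisits (λ ()) p q
  ... | inj₂ p | _      | inj₁ q = cycle-revisits (λ ()) p q
  ... | inj₂ p | _      | inj₂ q = cycle-revisits (cycSuc²-≢ 1F ∘ ≡.sym) p q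

  cycle-closed : (Q : Fin (n X) → Set) → (∀ {u v} → Adj X u v → Q u → Q v) →
    Q (vtx C 0F) → ∀ i → Q (vtx C i)
  cycle-closed Q closed q₀ = cycSuc-induction (Q ∘ vtx C) q₀ (λ i → closed (edges C i))

subClique : ∀ {X w w'} → Clique X w → (e : Fin w' → Fin w) → Injective _≡_ _≡_ e → Clique X w'
subClique K e e-inj = record
  { cv = cv K ∘ e ; cinj = e-inj ∘ cinj K ; cadj = λ i j i≢j → cadj K (e i) (e j) (i≢j ∘ e-inj) }

shrinkClique : ∀ {X w w'} → w' ≤ w → Clique X w → Clique X w'
shrinkClique w'≤w K =
  subClique K (λ i → inject≤ i w'≤w) (λ {i} {j} → FinP.inject≤-injective w'≤w w'≤w i j)

clique-size≤order : ∀ {X w} → Clique X w → w ≤ n X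
clique-size≤order K = FinP.injective⇒≤ (cinj K)

clique-closed : ∀ {X w} (K : Clique X (suc w)) (Q : Fin (n X) → Set) →
  (∀ {u v} → Adj X u v → Q u → Q v) → Q (cv K 0F) → ∀ i → Q (cv K i)
clique-closed K Q closed q₀ zero    = q₀
clique-closed K Q closed q₀ (suc i) = closed (cadj K 0F (suc i) (λ ())) q₀

IsComplete : Graph → Set
IsComplete X = ∀ u v → u ≢ v → Adj X u v

complete-clique : ∀ {X} → IsComplete X → Clique X (n X)
complete-clique X-complete = record { cv = id ; cinj = id ; cadj = X-complete }

complete-or-non-edge : ∀ X → IsComplete X ⊎ ∃₂ λ u v → u ≢ v × ¬ Adj X u v
complete-or-non-edge X = pairwise-or-counterexample (λ u v → adj X u v Bool.≟ true)

HasChord : (X : Graph) {l : ℕ} → CycleIn X (λ _ → ⊤) (suc l) → Set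
HasChord X {l} C = Σ (Fin (4 + l)) λ i → Σ (Fin (4 + l)) λ j →
  Adj X (vtx C i) (vtx C j) × i ≢ j × j ≢ cycSuc i × i ≢ cycSuc j

square-chord-is-diagonal : ∀ (i j : Fin 4) → i ≢ j → j ≢ cycSuc i → i ≢ cycSuc j →
  j ≡ cycSuc (cycSuc i)
square-chord-is-diagonal 0F 2F _ _ _ = refl
square-chord-is-diagonal 1F 3F _ _ _ = refl
square-chord-is-diagonal 2F 0F _ _ _ = refl
square-chord-is-diagonal 3F 1F _ _ _ = refl
square-chord-is-diagonal 0F 0F i≢j _ _ = ⊥-elim (i≢j refl)
square-chord-is-diagonal 1F 1F i≢j _ _ = ⊥-elim (i≢j refl)
square-chord-is-diagonal 2F 2F i≢j _ _ = ⊥-elim (i≢j refl)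
square-chord-is-diagonal 3F 3F i≢j _ _ = ⊥-elim (i≢j refl)
square-chord-is-diagonal 0F 1F _ j≢i+1 _ = ⊥-elim (j≢i+1 refl)
square-chord-is-diagonal 1F 2F _ j≢i+1 _ = ⊥-elim (j≢i+1 refl)
square-chord-is-diagonal 2F 3F _ j≢i+1 _ = ⊥-elim (j≢i+1 refl)
square-chord-is-diagonal 3F 0F _ j≢i+1 _ = ⊥-elim (j≢i+1 refl)
square-chord-is-diagonal 1F 0F _ _ i≢j+1 = ⊥-elim (i≢j+1 refl)
square-chord-is-diagonal 2F 1F _ _ i≢j+1 = ⊥-elim (i≢j+1 refl)
square-chord-is-diagonal 3F 2F _ _ i≢j+1 = ⊥-elim (i≢j+1 refl)
square-chord-is-diagonal 0F 3F _ _ i≢j+1 = ⊥-elim (i≢j+1 refl)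

chordal-square : ∀ {X} → Chordal X → (C : CycleIn X (λ _ → ⊤) 1) →
  Adj X (vtx C 0F) (vtx C 2F) ⊎ Adj X (vtx C 1F) (vtx C 3F)
chordal-square {X} X-chordal C with X-chordal 0 C
... | i , j , i~j , i≢j , j≢i+1 , i≢j+1
  with refl ← square-chord-is-diagonal i j i≢j j≢i+1 i≢j+1 = diagonal i i~j
  where
  diagonal : ∀ i → Adj X (vtx C i) (vtx C (cycSuc (cycSuc i))) →
    Adj X (vtx C 0F) (vtx C 2F) ⊎ Adj X (vtx C 1F) (vtx C 3F)
  diagonal 0F = inj₁
  diagonal 1F = inj₂
  diagonal 2F = inj₁ ∘ Adj-sym {X}
  diagonal 3F = inj₂ ∘ Adj-sym {X}

record _↪_ (A X : Graph) : Set where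
  field
    vmap           : Fin (n A) → Fin (n X)
    vmap-injective : Injective _≡_ _≡_ vmap
    adj-vmap       : ∀ u v → adj X (vmap u) (vmap v) ≡ adj A u v
open _↪_

Image : ∀ {A X} → A ↪ X → Fin (n X) → Set
Image φ u = ∃ λ x → vmap φ x ≡ u

module _ {A X : Graph} (φ : A ↪ X) where

  ↪-preserves : ∀ {u v} → Adj A u v → Adj X (vmap φ u) (vmap φ v)
  ↪-preserves {u} {v} = trans (adj-vmap φ u v)

  ↪-reflects : ∀ {u v} → Adj X (vmap φ u) (vmap φ v) → Adj A u v
  ↪-reflects {u} {v} = trans (≡.sym (adj-vmap φ u v))

  pushCycle : ∀ {P Q l} → (∀ {v} → P v → Q (vmap φ v)) → CycleIn A P l → CycleIn X Q l
  pushCycle = mapCycle (vmap φ) (vmap-injective φ) ↪-preserves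

  pushClique : ∀ {w} → Clique A w → Clique X w
  pushClique K = record
    { cv = vmap φ ∘ cv K ; cinj = cinj K ∘ vmap-injective φ
    ; cadj = λ i j i≢j → ↪-preserves (cadj K i j i≢j) }

  restrictCycle : ∀ {P l} (C : CycleIn X P l) → (∀ i → Image φ (vtx C i)) → CycleIn A (P ∘ vmap φ) l
  restrictCycle {P} C im = record
    { vtx   = proj₁ ∘ im
    ; inj   = λ e → inj C (trans (≡.sym (proj₂ (im _))) (trans (cong (vmap φ) e) (proj₂ (im _))))
    ; inP   = λ i → subst P (≡.sym (proj₂ (im i))) (inP C i)
    ; edges = λ i → ↪-reflects
        (subst₂ (Adj X) (≡.sym (proj₂ (im i))) (≡.sym (proj₂ (im (cycSuc i)))) (edges C i)) }

  restrictClique : ∀ {w} (K : Clique X w) → (∀ i → Image φ (cv K i)) → Clique A w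
  restrictClique K im = record
    { cv   = proj₁ ∘ im
    ; cinj = λ e → cinj K (trans (≡.sym (proj₂ (im _))) (trans (cong (vmap φ) e) (proj₂ (im _))))
    ; cadj = λ i j i≢j → ↪-reflects
        (subst₂ (Adj X) (≡.sym (proj₂ (im i))) (≡.sym (proj₂ (im j))) (cadj K i j i≢j)) }

  chordal-↪ : Chordal X → Chordal A
  chordal-↪ X-chordal l C with X-chordal l (pushCycle _ C)
  ... | i , j , i~j , non-consecutive = i , j , ↪-reflects i~j , non-consecutive

  restrict-chord : Chordal A → ∀ {l} (C : CycleIn X (λ _ → ⊤) (suc l)) →
    (∀ i → Image φ (vtx C i)) → HasChord X C
  restrict-chord A-chordal C im with A-chordal _ (restrictCycle C im)
  ... | i , j , i~j , non-consecutive =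
    i , j , subst₂ (Adj X) (proj₂ (im i)) (proj₂ (im j)) (↪-preserves i~j) , non-consecutive

induced : (X : Graph) {m : ℕ} → (Fin m → Fin (n X)) → Graph
induced X {m} f = record
  { n = m ; adj = λ u v → adj X (f u) (f v) ; sym = λ u v → sym X (f u) (f v) ; irrefl = irrefl X ∘ f }

induced-↪ : ∀ X {m} (f : Fin m → Fin (n X)) → Injective _≡_ _≡_ f → induced X f ↪ X
induced-↪ X f f-inj = record { vmap = f ; vmap-injective = f-inj ; adj-vmap = λ _ _ → refl }

≅-sym : ∀ {G H} → G ≅ H → H ≅ G
≅-sym {G} {H} φ = record
  { to = from ; from = to ; from∘to = to∘from ; to∘from = from∘to
  ; pres = λ u v → trans (≡.sym (pres (from u) (from v))) (≡.cong₂ (adj H) (to∘from u) (to∘from v)) }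
  where open _≅_ φ

≅⇒↪ : ∀ {G H} → G ≅ H → G ↪ H
≅⇒↪ φ = record
  { vmap = to
  ; vmap-injective = λ {u} {v} e → trans (≡.sym (from∘to u)) (trans (cong from e) (from∘to v))
  ; adj-vmap = pres }
  where open _≅_ φ

module _ (b : Bool) (G H : Graph) where

  combAdj-ll : ∀ x y → combAdj b G H (x ↑ˡ n H) (y ↑ˡ n H) ≡ adj G x y
  combAdj-ll x y rewrite FinP.splitAt-↑ˡ (n G) x (n H) | FinP.splitAt-↑ˡ (n G) y (n H) = refl

  combAdj-rr : ∀ x y → combAdj b G H (n G ↑ʳ x) (n G ↑ʳ y) ≡ adj H x y
  combAdj-rr x y rewrite FinP.splitAt-↑ʳ (n G) (n H) x | FinP.splitAt-↑ʳ (n G) (n H) y = refl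

  combAdj-lr : ∀ x y → combAdj b G H (x ↑ˡ n H) (n G ↑ʳ y) ≡ b
  combAdj-lr x y rewrite FinP.splitAt-↑ˡ (n G) x (n H) | FinP.splitAt-↑ʳ (n G) (n H) y = refl

  combAdj-rl : ∀ y x → combAdj b G H (n G ↑ʳ y) (x ↑ˡ n H) ≡ b
  combAdj-rl y x rewrite FinP.splitAt-↑ˡ (n G) x (n H) | FinP.splitAt-↑ʳ (n G) (n H) y = refl

  left↪ : G ↪ combine b G H
  left↪ = record
    { vmap = _↑ˡ n H ; vmap-injective = λ {x} {y} → FinP.↑ˡ-injective (n H) x y ; adj-vmap = combAdj-ll }

  right↪ : H ↪ combine b G H
  right↪ = record
    { vmap = n G ↑ʳ_ ; vmap-injective = λ {x} {y} → FinP.↑ʳ-injective (n G) x y ; adj-vmap = combAdj-rr }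

  left-or-right : ∀ u → Image left↪ u ⊎ Image right↪ u
  left-or-right u with side (n G) (n H) u
  ... | left x  = inj₁ (x , refl)
  ... | right y = inj₂ (y , refl)

  left? : ∀ u → Dec (Image left↪ u)
  left? u with side (n G) (n H) u
  ... | left x  = yes (x , refl)
  ... | right y = no λ (x , e) → ↑ˡ≢↑ʳ x y e

  ¬left⇒right : ∀ {u} → ¬ Image left↪ u → Image right↪ u
  ¬left⇒right {u} ¬left with left-or-right u
  ... | inj₁ l = ⊥-elim (¬left l)
  ... | inj₂ r = r

swapIso : ∀ b G H → combine b G H ≅ combine b H G
swapIso b G H = record
  { to = swap (n G) (n H) ; from = swap (n H) (n G)
  ; from∘to = swap-involutive (n G) (n H) ; to∘from = swap-involutive (n H) (n G)
  ; pres = swap-adj }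
  where
  swap : ∀ m k → Fin (m + k) → Fin (k + m)
  swap m k = Fin.join k m ∘ Sum.swap ∘ splitAt m
  swap-involutive : ∀ m k u → swap k m (swap m k u) ≡ u
  swap-involutive m k u rewrite FinP.splitAt-join k m (Sum.swap (splitAt m u))
    | SumP.swap-involutive (splitAt m u) = FinP.join-splitAt m k u
  swap-adj : ∀ u v → combAdj b H G (swap (n G) (n H) u) (swap (n G) (n H) v) ≡ combAdj b G H u v
  swap-adj u v rewrite FinP.splitAt-join (n H) (n G) (Sum.swap (splitAt (n G) u))
    | FinP.splitAt-join (n H) (n G) (Sum.swap (splitAt (n G) v))
    with splitAt (n G) u | splitAt (n G) v
  ... | inj₁ _ | inj₁ _ = refl
  ... | inj₁ _ | inj₂ _ = refl
  ... | inj₂ _ | inj₁ _ = refl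
  ... | inj₂ _ | inj₂ _ = refl

module _ {G H : Graph} where
  private
    L = left↪ false G H
    R = right↪ false G H

  union-left-closed : ∀ {u v} → Adj (combine false G H) u v → Image L u → Image L v
  union-left-closed {v = v} u~v (x , refl) with side (n G) (n H) v
  ... | left y  = y , refl
  ... | right y = ⊥-elim (no-edge {combine false G H} (combAdj-lr false G H x y) u~v)

  union-right-closed : ∀ {u v} → Adj (combine false G H) u v → Image R u → Image R v
  union-right-closed {v = v} u~v (y , refl) with side (n G) (n H) v
  ... | left x  = ⊥-elim (no-edge {combine false G H} (combAdj-rl false G H y x) u~v)
  ... | right x = x , refl

  union-cycle-side : ∀ {P l} (C : CycleIn (combine false G H) P l) →
    (∀ i → Image L (vtx C i)) ⊎ (∀ i → Image R (vtx C i))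
  union-cycle-side C with left-or-right false G H (vtx C 0F)
  ... | inj₁ l = inj₁ (cycle-closed C (Image L) union-left-closed l)
  ... | inj₂ r = inj₂ (cycle-closed C (Image R) union-right-closed r)

  union-clique-side : ∀ {w} (K : Clique (combine false G H) (suc w)) →
    (∀ i → Image L (cv K i)) ⊎ (∀ i → Image R (cv K i))
  union-clique-side K with left-or-right false G H (cv K 0F)
  ... | inj₁ l = inj₁ (clique-closed K (Image L) union-left-closed l)
  ... | inj₂ r = inj₂ (clique-closed K (Image R) union-right-closed r)

  chordal-union : Chordal G → Chordal H → Chordal (combine false G H)
  chordal-union G-chordal H-chordal l C with union-cycle-side C
  ... | inj₁ onG = restrict-chord L G-chordal C onG
  ... | inj₂ onH = restrict-chord R H-chordal C onH

square : ∀ {m k} → Fin m → Fin k → Fin m → Fin k → Fin 4 → Fin (m + k)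
square {k = k} x y x' y' 0F = x ↑ˡ k
square {m = m} x y x' y' 1F = m ↑ʳ y
square {k = k} x y x' y' 2F = x' ↑ˡ k
square {m = m} x y x' y' 3F = m ↑ʳ y'

square-injective : ∀ {m k} {x x' : Fin m} {y y' : Fin k} → x ≢ x' → y ≢ y' →
  Injective _≡_ _≡_ (square x y x' y')
square-injective {m} {k} {x} {x'} {y} {y'} x≢x' y≢y' {i} {j} = go i j
  where
  go : ∀ i j → square x y x' y' i ≡ square x y x' y' j → i ≡ j
  go 0F 0F _ = refl
  go 1F 1F _ = refl
  go 2F 2F _ = refl
  go 3F 3F _ = refl
  go 0F 2F e = ⊥-elim (x≢x' (FinP.↑ˡ-injective k x x' e))
  go 2F 0F e = ⊥-elim (x≢x' (FinP.↑ˡ-injective k x x' (≡.sym e)))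
  go 1F 3F e = ⊥-elim (y≢y' (FinP.↑ʳ-injective m y y' e))
  go 3F 1F e = ⊥-elim (y≢y' (FinP.↑ʳ-injective m y y' (≡.sym e)))
  go 0F 1F e = ⊥-elim (↑ˡ≢↑ʳ _ _ e)
  go 0F 3F e = ⊥-elim (↑ˡ≢↑ʳ _ _ e)
  go 2F 1F e = ⊥-elim (↑ˡ≢↑ʳ _ _ e)
  go 2F 3F e = ⊥-elim (↑ˡ≢↑ʳ _ _ e)
  go 1F 0F e = ⊥-elim (↑ˡ≢↑ʳ _ _ (≡.sym e))
  go 1F 2F e = ⊥-elim (↑ˡ≢↑ʳ _ _ (≡.sym e))
  go 3F 0F e = ⊥-elim (↑ˡ≢↑ʳ _ _ (≡.sym e))
  go 3F 2F e = ⊥-elim (↑ˡ≢↑ʳ _ _ (≡.sym e))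

joinSquare : ∀ {G H P} {x x' : Fin (n G)} {y y' : Fin (n H)} → x ≢ x' → y ≢ y' →
  (∀ i → P (square x y x' y' i)) → CycleIn (combine true G H) P 1
joinSquare {G} {H} {x = x} {x'} {y} {y'} x≢x' y≢y' inP = record
  { vtx = square x y x' y' ; inj = square-injective x≢x' y≢y' ; inP = inP ; edges = cross }
  where
  cross : ∀ i → Adj (combine true G H) (square x y x' y' i) (square x y x' y' (cycSuc i))
  cross 0F = combAdj-lr true G H x y
  cross 1F = combAdj-rl true G H y x'
  cross 2F = combAdj-lr true G H x' y'
  cross 3F = combAdj-rl true G H y' x

complete : ℕ → Graph
complete m = record { n = m ; adj = λ u v → Bool.not ⌊ u FinP.≟ v ⌋ ; sym = ≟-sym ; irrefl = ≟-irrefl }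
  where
  ≟-sym : ∀ (u v : Fin m) → Bool.not ⌊ u FinP.≟ v ⌋ ≡ Bool.not ⌊ v FinP.≟ u ⌋
  ≟-sym u v with u FinP.≟ v | v FinP.≟ u
  ... | yes _   | yes _   = refl
  ... | no _    | no _    = refl
  ... | yes u≡v | no v≢u  = ⊥-elim (v≢u (≡.sym u≡v))
  ... | no u≢v  | yes v≡u = ⊥-elim (u≢v (≡.sym v≡u))
  ≟-irrefl : ∀ (v : Fin m) → Bool.not ⌊ v FinP.≟ v ⌋ ≡ false
  ≟-irrefl v with v FinP.≟ v
  ... | yes _   = refl
  ... | no v≢v  = ⊥-elim (v≢v refl)

complete-adj : ∀ {m} {u v : Fin m} → u ≢ v → Adj (complete m) u v
complete-adj {u = u} {v} u≢v with u FinP.≟ v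
... | yes u≡v = ⊥-elim (u≢v u≡v)
... | no _    = refl

chordal-complete : ∀ m → Chordal (complete m)
chordal-complete m l C = 0F , 2F , complete-adj ((λ ()) ∘ inj C) , (λ ()) , (λ ()) , (λ ())

module _ {G : Graph} {m : ℕ} where
  private
    J = combine true G (complete m)

  join-complete-apex : ∀ y u → n G ↑ʳ y ≢ u → Adj J (n G ↑ʳ y) u
  join-complete-apex y u y≢u with side (n G) m u
  ... | left x   = combAdj-rl true G (complete m) y x
  ... | right y' = trans (combAdj-rr true G (complete m) y y') (complete-adj (y≢u ∘ cong (n G ↑ʳ_)))

  chordal-join-complete : Chordal G → Chordal J
  chordal-join-complete G-chordal l C with FinP.all? (left? true G (complete m) ∘ vtx C)
  ... | yes onG  = restrict-chord (left↪ true G (complete m)) G-chordal C onG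
  ... | no ¬onG with FinP.¬∀⟶∃¬ _ _ (left? true G (complete m) ∘ vtx C) ¬onG
  ...   | i , ¬left with ¬left⇒right true G (complete m) ¬left
  ...     | y , y↦i = i , j , subst (λ u → Adj J u (vtx C j)) y↦i apex ,
                      cycSuc²-≢ i ∘ ≡.sym , cycSuc-≢ (cycSuc i) , cycSuc³-≢ i ∘ ≡.sym
    where
    j = cycSuc (cycSuc i)
    apex : Adj J (n G ↑ʳ y) (vtx C j)
    apex = join-complete-apex y (vtx C j) λ e → cycSuc²-≢ i (≡.sym (inj C (trans (≡.sym y↦i) e)))

Avoids : ∀ {G j m} → AcyclicColoring G j → (Fin m → Fin j) → Set
Avoids {G} c s = ∀ (v : Fin (n G)) i → col c v ≢ s i

pullColoring : ∀ {A X k} → A ↪ X → AcyclicColoring X k → AcyclicColoring A k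
pullColoring φ c = record
  { col = col c ∘ vmap φ
  ; proper = λ u v u~v → proper c _ _ (↪-preserves φ u~v)
  ; acyclic = λ a b l C → acyclic c a b l (pushCycle φ id C) }

recolor : ∀ {G k k'} (ι : Fin k → Fin k') → Injective _≡_ _≡_ ι →
  AcyclicColoring G k → AcyclicColoring G k'
recolor {G} {k} {k'} ι ι-inj c = record
  { col = ι ∘ col c ; proper = λ u v u~v → proper c u v u~v ∘ ι-inj ; acyclic = two-colored }
  where
  -- the fallback d is arbitrary: colors outside the image of ι occur on no vertex
  preimage : Fin k → Fin k' → Fin k
  preimage d a with FinP.any? (λ x → ι x FinP.≟ a)
  ... | yes (x , _) = x
  ... | no _        = d
  preimage-correct : ∀ {d a x} → ι x ≡ a → x ≡ preimage d a
  preimage-correct {d} {a} {x} ιx≡a with FinP.any? (λ x → ι x FinP.≟ a)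
  ... | yes (x' , ιx'≡a) = ι-inj (trans ιx≡a (≡.sym ιx'≡a))
  ... | no ¬∃            = ⊥-elim (¬∃ (x , ιx≡a))
  two-colored : ∀ a b → InducesForest G (λ v → ι (col c v) ≡ a ⊎ ι (col c v) ≡ b)
  two-colored a b l C = acyclic c (preimage d a) (preimage d b) l
    (weakenCycle (Sum.map preimage-correct preimage-correct) C)
    where d = col c (vtx C 0F)

module _ {G H : Graph} {k : ℕ} (cG : AcyclicColoring G k) (cH : AcyclicColoring H k) where
  private
    colU = col cG ++ col cH
    colU-left : ∀ x → colU (x ↑ˡ n H) ≡ col cG x
    colU-left = lookup-++ˡ (col cG) (col cH)
    colU-right : ∀ y → colU (n G ↑ʳ y) ≡ col cH y
    colU-right = lookup-++ʳ (col cG) (col cH)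

  unionColoring : AcyclicColoring (combine false G H) k
  unionColoring = record { col = colU ; proper = proper-union ; acyclic = acyclic-union }
    where
    proper-union : ∀ u v → Adj (combine false G H) u v → colU u ≢ colU v
    proper-union u v u~v e with side (n G) (n H) u | side (n G) (n H) v
    ... | left x  | left x'  = proper cG x x' (↪-reflects (left↪ false G H) u~v)
                                 (subst₂ _≡_ (colU-left x) (colU-left x') e)
    ... | right y | right y' = proper cH y y' (↪-reflects (right↪ false G H) u~v)
                                 (subst₂ _≡_ (colU-right y) (colU-right y') e)
    ... | left x  | right y  = no-edge {combine false G H} (combAdj-lr false G H x y) u~v
    ... | right y | left x   = no-edge {combine false G H} (combAdj-rl false G H y x) u~v
    acyclic-union : ∀ a b → InducesForest (combine false G H) (λ v → colU v ≡ a ⊎ colU v ≡ b)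
    acyclic-union a b l C with union-cycle-side C
    ... | inj₁ onG = acyclic cG a b l
      (weakenCycle (Sum.map (subst (_≡ a) (colU-left _)) (subst (_≡ b) (colU-left _)))
                   (restrictCycle (left↪ false G H) C onG))
    ... | inj₂ onH = acyclic cH a b l
      (weakenCycle (Sum.map (subst (_≡ a) (colU-right _)) (subst (_≡ b) (colU-right _)))
                   (restrictCycle (right↪ false G H) C onH))

module _ {G H : Graph} {k : ℕ} (c : AcyclicColoring G k) where
  private
    J = combine true G H
    colJ = (λ x → col c x ↑ˡ n H) ++ (k ↑ʳ_)

    colJ-left : ∀ x → colJ (x ↑ˡ n H) ≡ col c x ↑ˡ n H
    colJ-left = lookup-++ˡ (λ x → col c x ↑ˡ n H) (k ↑ʳ_)

    colJ-right : ∀ y → colJ (n G ↑ʳ y) ≡ k ↑ʳ y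
    colJ-right = lookup-++ʳ (λ x → col c x ↑ˡ n H) (k ↑ʳ_)

    left-color : ∀ {x a} → colJ (x ↑ˡ n H) ≡ a ↑ˡ n H → col c x ≡ a
    left-color {x} e = FinP.↑ˡ-injective (n H) _ _ (trans (≡.sym (colJ-left x)) e)

    left-colored : ∀ {v a} → colJ v ≡ a ↑ˡ n H → ∃ λ x → x ↑ˡ n H ≡ v × col c x ≡ a
    left-colored {v} e with side (n G) (n H) v
    ... | left x  = x , refl , left-color e
    ... | right y = ⊥-elim (↑ˡ≢↑ʳ _ _ (trans (≡.sym e) (colJ-right y)))

    right-colored : ∀ {v y} → colJ v ≡ k ↑ʳ y → v ≡ n G ↑ʳ y
    right-colored {v} e with side (n G) (n H) v
    ... | left x  = ⊥-elim (↑ˡ≢↑ʳ _ _ (trans (≡.sym (colJ-left x)) e))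
    ... | right y = cong (n G ↑ʳ_) (FinP.↑ʳ-injective k _ _ (trans (≡.sym (colJ-right y)) e))

    proper-join : ∀ u v → Adj J u v → colJ u ≢ colJ v
    proper-join u v u~v e with side (n G) (n H) u | side (n G) (n H) v
    ... | left x  | left x'  =
      proper c x x' (↪-reflects (left↪ true G H) u~v) (left-color (trans e (colJ-left x')))
    ... | right y | right y' = adj-≢ {J} u~v (≡.sym (right-colored (trans (≡.sym e) (colJ-right y))))
    ... | left x  | right y  = ↑ˡ≢↑ʳ _ _ (subst₂ _≡_ (colJ-left x) (colJ-right y) e)
    ... | right y | left x   = ↑ˡ≢↑ʳ _ _ (subst₂ _≡_ (colJ-left x) (colJ-right y) (≡.sym e))

    -- the color k ↑ʳ y is carried by the single vertex n G ↑ʳ y, and the other color class is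
    -- independent, so every edge of such a cycle would pass through that vertex
    no-mixed-cycle : ∀ a y l → ¬ CycleIn J (λ v → colJ v ≡ a ↑ˡ n H ⊎ colJ v ≡ k ↑ʳ y) l
    no-mixed-cycle a y l C = cycle-not-star C (n G ↑ʳ y) through
      where
      through : ∀ i → vtx C i ≡ n G ↑ʳ y ⊎ vtx C (cycSuc i) ≡ n G ↑ʳ y
      through i with inP C i | inP C (cycSuc i)
      ... | inj₂ e | _      = inj₁ (right-colored e)
      ... | inj₁ _ | inj₂ e = inj₂ (right-colored e)
      ... | inj₁ e | inj₁ e' with left-colored e | left-colored e'
      ...   | x , x↦ , cx≡a | x' , x'↦ , cx'≡a =
        ⊥-elim (proper c x x'
          (↪-reflects (left↪ true G H) (subst₂ (Adj J) (≡.sym x↦) (≡.sym x'↦) (edges C i)))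
          (trans cx≡a (≡.sym cx'≡a)))

    acyclic-join : ∀ a b → InducesForest J (λ v → colJ v ≡ a ⊎ colJ v ≡ b)
    acyclic-join a b l C with side k (n H) a | side k (n H) b
    ... | left a' | left b' = acyclic c a' b' l (weakenCycle (Sum.map left-color left-color)
                                                             (restrictCycle (left↪ true G H) C onG))
      where
      onG : ∀ i → Image (left↪ true G H) (vtx C i)
      onG = Sum.[ map₂ proj₁ ∘ left-colored , map₂ proj₁ ∘ left-colored ] ∘ inP C
    ... | right a' | right b' = cycle-not-within-pair C (Sum.map right-colored right-colored ∘ inP C)
    ... | left a'  | right b' = no-mixed-cycle a' b' l C
    ... | right a' | left b'  = no-mixed-cycle b' a' l (weakenCycle Sum.swap C)

  joinColoring : AcyclicColoring J (k + n H)
  joinColoring = record { col = colJ ; proper = proper-join ; acyclic = acyclic-join }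

-- This stronger form of χₐ ≥ k is what survives a join, where the colors of an injectively
-- colored side are unavailable to the other side.
ColoringLowerBound : Graph → ℕ → Set
ColoringLowerBound G k = ∀ {j m} (c : AcyclicColoring G j) (s : Fin m → Fin j) →
  Injective _≡_ _≡_ s → Avoids c s → k + m ≤ j

lower-bound-++ : ∀ {A k j m p} → ColoringLowerBound A k → (c : AcyclicColoring A j)
  {s : Fin m → Fin j} {t : Fin p → Fin j} → Injective _≡_ _≡_ s → Injective _≡_ _≡_ t →
  (∀ i i' → s i ≢ t i') → Avoids c s → Avoids c t → k + p + m ≤ j
lower-bound-++ {k = k} {j} {m} {p} lb c {s} {t} s-inj t-inj s∉t avoids-s avoids-t =
  subst (_≤ j) rearrange (lb c (s ++ t) (++-injective s-inj t-inj s∉t) avoids-s++t)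
  where
  avoids-s++t : Avoids c (s ++ t)
  avoids-s++t v i with side m p i
  ... | left i'  = λ e → avoids-s v i' (trans e (lookup-++ˡ s t i'))
  ... | right i' = λ e → avoids-t v i' (trans e (lookup-++ʳ s t i'))
  rearrange : k + (m + p) ≡ k + p + m
  rearrange = trans (cong (k +_) (ℕP.+-comm m p)) (≡.sym (ℕP.+-assoc k p m))

join-coloring-injective-side : ∀ {G H j} (c : AcyclicColoring (combine true G H) j) →
  Injective _≡_ _≡_ (col c ∘ (n G ↑ʳ_)) ⊎ Injective _≡_ _≡_ (col c ∘ (_↑ˡ n H))
join-coloring-injective-side {G} {H} c
  with injective-or-collision (col c ∘ (n G ↑ʳ_)) | injective-or-collision (col c ∘ (_↑ˡ n H))
... | inj₁ H-injective | _                = inj₁ H-injective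
... | inj₂ _           | inj₁ G-injective = inj₂ G-injective
... | inj₂ (y , y' , y≢y' , cy≡cy') | inj₂ (x , x' , x≢x' , cx≡cx') =
  ⊥-elim (acyclic c (col c (x ↑ˡ n H)) (col c (n G ↑ʳ y)) 1 (joinSquare x≢x' y≢y' two-colored))
  where
  two-colored : ∀ i → let v = square x y x' y' i in
    col c v ≡ col c (x ↑ˡ n H) ⊎ col c v ≡ col c (n G ↑ʳ y)
  two-colored 0F = inj₁ refl
  two-colored 1F = inj₂ refl
  two-colored 2F = inj₁ (≡.sym cx≡cx')
  two-colored 3F = inj₂ (≡.sym cy≡cy')

join-lower-bound : ∀ {G H kG kH} → ColoringLowerBound G kG → ColoringLowerBound H kH →
  kG + n H ≤ kH + n G → ColoringLowerBound (combine true G H) (kG + n H)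
join-lower-bound {G} {H} lbG lbH le c s s-inj avoids with join-coloring-injective-side c
... | inj₁ H-injective =
  lower-bound-++ lbG (pullColoring (left↪ true G H) c) s-inj H-injective
    (λ i y → avoids (n G ↑ʳ y) i ∘ ≡.sym) (avoids ∘ (_↑ˡ n H))
    (λ x y → proper c _ _ (combAdj-lr true G H x y))
... | inj₂ G-injective = ℕP.≤-trans (ℕP.+-monoˡ-≤ _ le)
  (lower-bound-++ lbH (pullColoring (right↪ true G H) c) s-inj G-injective
    (λ i x → avoids (x ↑ˡ n H) i ∘ ≡.sym) (avoids ∘ (n G ↑ʳ_))
    (λ y x → proper c _ _ (combAdj-rl true G H y x)))

pullTriangulation : ∀ {A X} → A ↪ X → Triangulation X → Triangulation A
pullTriangulation φ T = record
  { tadj    = λ u v → tadj T (vmap φ u) (vmap φ v)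
  ; tsym    = λ u v → tsym T (vmap φ u) (vmap φ v)
  ; tirr    = tirr T ∘ vmap φ
  ; super   = λ u v u~v → super T _ _ (↪-preserves φ u~v)
  ; chordal = chordal-↪ (induced-↪ (tri T) (vmap φ) (vmap-injective φ)) (chordal T) }

pullTriangulation-↪ : ∀ {A X} (φ : A ↪ X) (T : Triangulation X) → tri (pullTriangulation φ T) ↪ tri T
pullTriangulation-↪ φ T = induced-↪ (tri T) (vmap φ) (vmap-injective φ)

combine-super : ∀ b {G H} (TG : Triangulation G) (TH : Triangulation H) u v →
  Adj (combine b G H) u v → Adj (combine b (tri TG) (tri TH)) u v
combine-super b {G} {H} TG TH u v u~v with side (n G) (n H) u | side (n G) (n H) v
... | left x  | left x'  =
  trans (combAdj-ll b (tri TG) (tri TH) x x') (super TG x x' (↪-reflects (left↪ b G H) u~v))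
... | right y | right y' =
  trans (combAdj-rr b (tri TG) (tri TH) y y') (super TH y y' (↪-reflects (right↪ b G H) u~v))
... | left x  | right y  = trans (combAdj-lr b (tri TG) (tri TH) x y) (trans (≡.sym (combAdj-lr b G H x y)) u~v)
... | right y | left x   = trans (combAdj-rl b (tri TG) (tri TH) y x) (trans (≡.sym (combAdj-rl b G H y x)) u~v)

combineTriangulation : ∀ b {G H} (TG : Triangulation G) (TH : Triangulation H) →
  Chordal (combine b (tri TG) (tri TH)) → Triangulation (combine b G H)
combineTriangulation b TG TH combination-chordal = record
  { tadj = combAdj b (tri TG) (tri TH) ; tsym = combSym b (tri TG) (tri TH)
  ; tirr = combIrr b (tri TG) (tri TH) ; super = combine-super b TG TH ; chordal = combination-chordal }

completeTriangulation : (H : Graph) → Triangulation H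
completeTriangulation H = record
  { tadj = adj (complete (n H)) ; tsym = sym (complete (n H)) ; tirr = irrefl (complete (n H))
  ; super = λ u v u~v → complete-adj (adj-≢ {H} u~v) ; chordal = chordal-complete (n H) }

clique-join-bound : ∀ {A B p q} → (∀ {w} → Clique A w → w ≤ p) → (∀ {w} → Clique B w → w ≤ q) →
  ∀ {w} → Clique (combine true A B) w → w ≤ p + q
clique-join-bound {A} {B} {p} {q} boundA boundB {w} K =
  subst (_≤ p + q) sizes (ℕP.+-mono-≤ (boundA onA) (boundB onB))
  where
  open Partition (partition w (left? true A B ∘ cv K))
  onA = restrictClique (left↪ true A B) (subClique K part₁ part₁-injective) part₁-P
  onB = restrictClique (right↪ true A B) (subClique K part₂ part₂-injective)
          (¬left⇒right true A B ∘ part₂-¬P)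

module _ {G H : Graph} (T : Triangulation (combine true G H)) where
  private
    L = left↪ true G H
    R = right↪ true G H
    TL = pullTriangulation L T
    TR = pullTriangulation R T

  joinClique : ∀ {a c} → Clique (tri TL) a → Clique (tri TR) c → Clique (tri T) (a + c)
  joinClique {a} {c} KG KH = record
    { cv = vs
    ; cinj = ++-injective (λ e → cinj KG (vmap-injective L e)) (λ e → cinj KH (vmap-injective R e))
                          (λ _ _ → ↑ˡ≢↑ʳ _ _)
    ; cadj = adjacent }
    where
    vsG = vmap L ∘ cv KG
    vsH = vmap R ∘ cv KH
    vs = vsG ++ vsH
    cross : ∀ x y → Adj (tri T) (x ↑ˡ n H) (n G ↑ʳ y)
    cross x y = super T _ _ (combAdj-lr true G H x y)
    at : ∀ {p q r s} → p ≡ q → r ≡ s → Adj (tri T) q s → Adj (tri T) p r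
    at p≡q r≡s = subst₂ (Adj (tri T)) (≡.sym p≡q) (≡.sym r≡s)
    adjacent : ∀ u v → u ≢ v → Adj (tri T) (vs u) (vs v)
    adjacent u v u≢v with side a c u | side a c v
    ... | left i  | left i'  =
      at (lookup-++ˡ vsG vsH i) (lookup-++ˡ vsG vsH i') (cadj KG i i' (u≢v ∘ cong (_↑ˡ c)))
    ... | right i | right i' =
      at (lookup-++ʳ vsG vsH i) (lookup-++ʳ vsG vsH i') (cadj KH i i' (u≢v ∘ cong (a ↑ʳ_)))
    ... | left i  | right i' = at (lookup-++ˡ vsG vsH i) (lookup-++ʳ vsG vsH i') (cross _ _)
    ... | right i | left i'  = at (lookup-++ʳ vsG vsH i) (lookup-++ˡ vsG vsH i') (Adj-sym {tri T} (cross _ _))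

  join-triangulation-diagonal : ∀ {x x' y y'} → x ≢ x' → y ≢ y' →
    Adj (tri T) (x ↑ˡ n H) (x' ↑ˡ n H) ⊎ Adj (tri T) (n G ↑ʳ y) (n G ↑ʳ y')
  join-triangulation-diagonal x≢x' y≢y' = chordal-square (chordal T)
    (mapCycle id id (λ {u} {v} → super T u v) id (joinSquare x≢x' y≢y' (λ _ → tt)))

  join-triangulation-complete-side : IsComplete (tri TR) ⊎ IsComplete (tri TL)
  join-triangulation-complete-side with complete-or-non-edge (tri TR) | complete-or-non-edge (tri TL)
  ... | inj₁ H-complete | _ = inj₁ H-complete
  ... | inj₂ _ | inj₁ G-complete = inj₂ G-complete
  ... | inj₂ (y , y' , y≢y' , y≁y') | inj₂ (x , x' , x≢x' , x≁x') =
    ⊥-elim (Sum.[ x≁x' , y≁y' ] (join-triangulation-diagonal x≢x' y≢y'))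

record AcyclicChromaticCertificate (G : Graph) (k : ℕ) : Set where
  field
    coloring    : AcyclicColoring G k
    lower-bound : ColoringLowerBound G k
open AcyclicChromaticCertificate

record TreewidthCertificate (G : Graph) (k : ℕ) : Set where
  field
    triangulation : Triangulation G
    clique-bound  : ∀ {w} → Clique (tri triangulation) w → w ≤ k
    forced-clique : (T : Triangulation G) → Clique (tri T) k
open TreewidthCertificate

Certified : Graph → ℕ → Set
Certified G k = AcyclicChromaticCertificate G k × TreewidthCertificate G k

isAcyclicChromaticNumber : ∀ {G k} → AcyclicChromaticCertificate G k → IsAcyclicChromaticNumber G k
isAcyclicChromaticNumber {k = k} A =
  coloring A , λ j c → subst (_≤ j) (ℕP.+-identityʳ k) (lower-bound A c (λ ()) (λ { {()} }) (λ _ ()))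

isTreewidth : ∀ {G t} → TreewidthCertificate G (suc t) → IsTreewidth G t
isTreewidth {t = t} C =
  (triangulation C , forced-clique C (triangulation C) , λ _ → clique-bound C) ,
  λ T w (_ , maximal) → maximal (suc t) (forced-clique C T)

K₁-acyclic : ∀ {P l} → ¬ CycleIn K₁ P l
K₁-acyclic C with edges C 0F
... | ()

K₁-certified : Certified K₁ 1
K₁-certified =
  record
    { coloring = record { col = λ _ → 0F ; proper = λ _ _ () ; acyclic = λ _ _ _ → K₁-acyclic }
    ; lower-bound = λ c s s-inj avoids → FinP.injective⇒≤ (∷-injective (avoids 0F) s-inj) } ,
  record
    { triangulation = record
        { tadj = λ _ _ → false ; tsym = λ _ _ → refl ; tirr = λ _ → refl
        ; super = λ _ _ () ; chordal = λ _ → ⊥-elim ∘ K₁-acyclic }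
    ; clique-bound = clique-size≤order
    ; forced-clique = λ _ → record
        { cv = λ _ → 0F
        ; cinj = λ { {0F} {0F} _ → refl }
        ; cadj = λ { 0F 0F 0≢0 → ⊥-elim (0≢0 refl) } } }

transport : ∀ {G H k} → G ≅ H → Certified G k → Certified H k
transport φ (A , T) =
  record
    { coloring = pullColoring back (coloring A)
    ; lower-bound = λ c s s-inj avoids →
        lower-bound A (pullColoring forth c) s s-inj (avoids ∘ vmap forth) } ,
  record
    { triangulation = pullTriangulation back (triangulation T)
    ; clique-bound = clique-bound T ∘ pushClique (pullTriangulation-↪ back (triangulation T))
    ; forced-clique = λ T' →
        pushClique (pullTriangulation-↪ forth T') (forced-clique T (pullTriangulation forth T')) }
  where
  forth = ≅⇒↪ φ
  back  = ≅⇒↪ (≅-sym φ)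

union-certified : ∀ {G H kG kH} → Certified G kG → Certified H kH → kH ≤ kG →
  Certified (combine false G H) kG
union-certified {G} {H} {kG} (AG , TG) (AH , TH) kH≤kG =
  record
    { coloring = unionColoring (coloring AG)
        (recolor (λ a → inject≤ a kH≤kG) (λ {a} {b} → FinP.inject≤-injective kH≤kG kH≤kG a b)
          (coloring AH))
    ; lower-bound = λ c s s-inj avoids →
        lower-bound AG (pullColoring (left↪ false G H) c) s s-inj (avoids ∘ (_↑ˡ n H)) } ,
  record
    { triangulation = combineTriangulation false (triangulation TG) (triangulation TH)
        (chordal-union (chordal (triangulation TG)) (chordal (triangulation TH)))
    ; clique-bound = bound
    ; forced-clique = λ T → pushClique (pullTriangulation-↪ (left↪ false G H) T)
        (forced-clique TG (pullTriangulation (left↪ false G H) T)) }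
  where
  TG' = tri (triangulation TG)
  TH' = tri (triangulation TH)
  bound : ∀ {w} → Clique (combine false TG' TH') w → w ≤ kG
  bound {zero}  _ = z≤n
  bound {suc w} K with union-clique-side K
  ... | inj₁ onG = clique-bound TG (restrictClique (left↪ false TG' TH') K onG)
  ... | inj₂ onH = ℕP.≤-trans (clique-bound TH (restrictClique (right↪ false TG' TH') K onH)) kH≤kG

join-certified : ∀ {G H kG kH} → Certified G kG → Certified H kH → kG + n H ≤ kH + n G →
  Certified (combine true G H) (kG + n H)
join-certified {G} {H} {kG} {kH} (AG , TG) (AH , TH) le =
  record
    { coloring = joinColoring (coloring AG)
    ; lower-bound = join-lower-bound (lower-bound AG) (lower-bound AH) le } ,
  record
    { triangulation = combineTriangulation true (triangulation TG) (completeTriangulation H)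
        (chordal-join-complete (chordal (triangulation TG)))
    ; clique-bound = clique-join-bound (clique-bound TG) clique-size≤order
    ; forced-clique = forced }
  where
  forced : ∀ T → Clique (tri T) (kG + n H)
  forced T with join-triangulation-complete-side T
  ... | inj₁ H-complete =
    joinClique T (forced-clique TG (pullTriangulation (left↪ true G H) T)) (complete-clique H-complete)
  ... | inj₂ G-complete = shrinkClique (subst (kG + n H ≤_) (ℕP.+-comm kH (n G)) le)
    (joinClique T (complete-clique G-complete) (forced-clique TH (pullTriangulation (right↪ true G H) T)))

certify : ∀ {G} → IsCograph G → Σ ℕ λ t → Certified G (suc t)
certify single = 0 , K₁-certified
certify (union {G} {H} g h) with certify g | certify h
... | tG , CG | tH , CH with ℕP.≤-total tH tG
...   | inj₁ tH≤tG = tG , union-certified CG CH (s≤s tH≤tG)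
...   | inj₂ tG≤tH = tH , transport (swapIso false H G) (union-certified CH CG (s≤s tG≤tH))
certify (join {G} {H} g h) with certify g | certify h
... | tG , CG | tH , CH with ℕP.≤-total (suc tG + n H) (suc tH + n G)
...   | inj₁ le = tG + n H , join-certified CG CH le
...   | inj₂ ge = tH + n G , transport (swapIso true H G) (join-certified CH CG ge)
certify (iso φ g) with certify g
... | t , C = t , transport φ C

theorem4 : (G : Graph) → IsCograph G →
    Σ ℕ (λ t → IsTreewidth G t × IsAcyclicChromaticNumber G (suc t))
theorem4 G g with certify g
... | t , (acyclic-certificate , treewidth-certificate) =
  t , isTreewidth treewidth-certificate , isAcyclicChromaticNumber acyclic-certificate
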